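{- Let $p$ be an odd prime and $D_{2p}=\langle \tau,\sigma\mid \tau^p=\sigma^2=e,\ \sigma\tau\sigma=\tau^{ -1}\rangle=\{\tau^i,\tau^j\sigma\mid i,j\in\mathbb{Z}_p\}$. For $s\in\mathbb{Z}_p^\times$ and $t\in\mathbb{Z}_p$ let $\alpha_{s,t}$ be the automorphism of $D_{2p}$ given by $\alpha_{s,t}(\tau^i)=\tau^{si}$ and $\alpha_{s,t}(\tau^j\sigma)=\tau^{sj+t}\sigma$. Let $A=D_{2p}\setminus\{e\}$ (so $|A|=2p-1$), on which $\mathrm{Aut}(D_{2p})$ acts naturally, and for a permutation $g$ of $A$ let $b_k(g)$ denote the number of cycles of length $k$ in the disjoint cycle decomposition of $g$ ($1\le k\le 2p-1$). Let $z$ be a generator of the cyclic group $\mathbb{Z}_p^\times$, and for $s\in\mathbb{Z}_p^\times$ let $i_s\in\mathbb{Z}_{p-1}$ be such that $s=z^{i_s}$. Then: (i) for $t\in\mathbb{Z}_p$, $b_k(\alpha_{1,t})=2p-1$ if $k=1$ and $t=0$; $b_k(\alpha_{1,t})=p-1$ if $k=1$ and $t\neq 0$; $b_k(\alpha_{1,t})=1$ if $k=p$ and $t\neq 0$; and $b_k(\alpha_{1,t})=0$ otherwise; (ii) for $s\neq 1$ (i.e. $i_s\neq 0$) and every $t\in\mathbb{Z}_p$, $b_k(\alpha_{s,t})=b_k(\alpha_{s,0})$ for all $k$, and $b_k(\alpha_{s,t})=1$ if $k=1$, $b_k(\alpha_{s,t})=2\gcd(i_s,p-1)$ if $k=\frac{p-1}{\gcd(i_s,p-1)}$,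 and $b_k(\alpha_{s,t})=0$ otherwise.
   Context: Here $\mathbb{Z}_p^\times=\mathbb{Z}_p\setminus\{0\}$ is the multiplicative group of units modulo $p$, which is cyclic of order $p-1$; the automorphism group of $D_{2p}$ is exactly $\{\alpha_{s,t}\mid s\in\mathbb{Z}_p^\times,t\in\mathbb{Z}_p\}$. -}

module Defs where

open import Data.Nat using (ℕ; NonZero; zero; suc; _+_; _*_; _∸_; _%_; _≤_; _<_; _≤?_)
open import Data.Nat.Properties using (_≟_)
open import Data.Nat.GCD using (gcd; gcd[m,n]∣n)
open import Data.Nat.Divisibility using (_∣_)
open import Data.Fin using (Fin; toℕ)
open import Data.Fin.Properties using (all?)
open import Data.List using (List; []; _∷_; map; _++_; filter; length; upTo)
open import Data.Product using (_×_; _,_)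
open import Data.Empty using (⊥)
open import Relation.Nullary using (Dec; yes; no; ¬_)
open import Relation.Nullary.Decidable using (_×-dec_; ¬?)
open import Relation.Binary.PropositionalEquality using (_≡_; refl; cong)

-- The dihedral group D_{2p} = { τ^i , τ^j σ | i, j ∈ ℤ_p }.
-- An element is either a rotation  rot i = τ^i  or a reflection
-- ref j = τ^j σ, with exponents taken in {0,…,p-1} (residues mod p).

data D : Set where
  rot : ℕ → D
  ref : ℕ → D

rot-inj : ∀ {i j} → rot i ≡ rot j → i ≡ j
rot-inj refl = refl

ref-inj : ∀ {i j} → ref i ≡ ref j → i ≡ j
ref-inj refl = refl

_≟D_ : (x y : D) → Dec (x ≡ y)
rot i ≟D rot j with i ≟ j
... | yes e = yes (cong rot e)
... | no ne = no (λ e → ne (rot-inj e))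
rot i ≟D ref j = no (λ ())
ref i ≟D rot j = no (λ ())
ref i ≟D ref j with i ≟ j
... | yes e = yes (cong ref e)
... | no ne = no (λ e → ne (ref-inj e))

-- an injective encoding of D into ℕ, used to pick a canonical
-- representative of each cycle
code : D → ℕ
code (rot i) = 2 * i
code (ref j) = suc (2 * j)

A : ℕ → List D
A p = map (λ i → rot (suc i)) (upTo (p ∸ 1)) ++ map ref (upTo p)

α : (p : ℕ) .{{_ : NonZero p}} (s t : ℕ) → D → D
α p s t (rot i) = rot ((s * i) % p)
α p s t (ref j) = ref ((s * j + t) % p)

iter : (D → D) → ℕ → D → D
iter g zero    x = x
iter g (suc n) x = g (iter g n x)

HasPeriod : (D → D) → ℕ → D → Set
HasPeriod g zero    x = ⊥
HasPeriod g (suc k) x =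
  (iter g (suc k) x ≡ x) × ((m : Fin k) → ¬ (iter g (suc (toℕ m)) x ≡ x))

hasPeriod? : (g : D → D) (k : ℕ) (x : D) → Dec (HasPeriod g k x)
hasPeriod? g zero    x = no (λ ())
hasPeriod? g (suc k) x =
  (iter g (suc k) x ≟D x) ×-dec all? (λ m → ¬? (iter g (suc (toℕ m)) x ≟D x))

IsRep : (D → D) → ℕ → D → Set
IsRep g k x = (m : Fin k) → code x ≤ code (iter g (toℕ m) x)

isRep? : (g : D → D) (k : ℕ) (x : D) → Dec (IsRep g k x)
isRep? g k x = all? (λ m → code x ≤? code (iter g (toℕ m) x))

-- b_k(g) = number of cycles of length k in the disjoint cycle decomposition
-- of g restricted to A = D_{2p} \ {e}: one canonical point per k-cycle.
b : (p : ℕ) → (g : D → D) → (k : ℕ) → ℕ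
b p g k = length (filter (λ x → hasPeriod? g k x ×-dec isRep? g k x) (A p))

IsUnit : ℕ → ℕ → Set
IsUnit p s = (1 ≤ s) × (s < p)

IsGenerator : (p : ℕ) .{{_ : NonZero p}} → ℕ → Set
IsGenerator p z = IsUnit p z ×
  ((s : ℕ) → IsUnit p s → Data.Product.∃ λ i → (i < p ∸ 1) × (Data.Nat._^_ z i % p ≡ s))

cycLen : ℕ → ℕ → ℕ
cycLen p i = _∣_.quotient (gcd[m,n]∣n i (p ∸ 1))

-- Count b_k(g) · k instead of b_k(g): it is the number of points of A of period exactly k under g,
-- since every k-cycle has k points and b counts it once, through its point of least code.
-- α_{1,t} fixes every rotation and shifts reflection exponents by t, so for t ≠ 0 the p reflections
-- form one p-cycle. For s = z^i ≠ 1 the rotation τ^a returns after m steps iff s^m ≡ 1 (mod p), that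
-- is, iff (p-1)/gcd(i,p-1) divides m, because z has order p-1. On the reflections, τ^jσ ↦ τ^{(s-1)j+t}
-- intertwines α_{s,t} with its action on the rotations (the identity included), so exactly one
-- reflection is fixed and the other p-1 have the same period as the nontrivial rotations.

module Submission where

open import Defs
open import Data.Empty using (⊥; ⊥-elim)
open import Data.Fin using (Fin; toℕ; fromℕ<; punchOut)
open import Data.Fin.Properties
  using (toℕ-fromℕ<; fromℕ<-injective; toℕ<n; toℕ-injective; any?; punchOut-injective; injective⇒≤)
open import Data.List using (List; []; _∷_; map; _++_; filter; length; upTo; tabulate)
open import Data.List.Extrema.Nat using (argmin; argmin-sel; f[argmin]≤f[xs])
open import Data.List.Membership.Propositional using (_∈_)
open import Data.List.Membership.Propositional.Properties
  using (∈-filter⁺; ∈-filter⁻; ∈-tabulate⁺; ∈-tabulate⁻; ∈-map⁺; ∈-map⁻; ∈-upTo⁺; ∈-upTo⁻; ∈-++⁺ˡ; ∈-++⁺ʳ; ∈-++⁻)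
open import Data.List.Membership.Propositional.Properties.WithK using (unique∧set⇒bag)
open import Data.List.Membership.DecPropositional _≟D_ using (_∈?_)
open import Data.List.Properties
  using (length-++; length-map; length-upTo; length-tabulate; length-filter; filter-++; filter-all; filter-none; filter-reject)
open import Data.List.Relation.Binary.BagAndSetEquality using (∼bag⇒↭)
open import Data.List.Relation.Binary.Permutation.Propositional.Properties using (↭-length)
open import Data.List.Relation.Unary.All as All using (All)
open import Data.List.Relation.Unary.Any using (here)
open import Data.List.Relation.Unary.Unique.Propositional using (Unique; []; _∷_)
import Data.List.Relation.Unary.Unique.Propositional.Properties as Unique
open import Data.Nat using (ℕ; NonZero; zero; suc; _+_; _*_; _∸_; _^_; _%_; _/_; _≤_; _<_; z≤n; s≤s)
open import Data.Nat using (>-nonZero; >-nonZero⁻¹; ≢-nonZero; ≢-nonZero⁻¹; nonTrivial⇒n>1)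
open import Data.Nat.Coprimality using (Coprime; coprime-divisor)
open import Data.Nat.DivMod
open import Data.Nat.Divisibility
open import Data.Nat.GCD using (gcd; gcd[m,n]∣m; gcd[m,n]∣n; gcd-greatest; gcd[m,n]≡0⇒n≡0)
open import Data.Nat.Primality using (Prime; euclidsLemma; prime⇒nonTrivial)
open import Data.Nat.Properties
open import Data.Nat.Tactic.RingSolver using (solve-∀)
open import Data.Product using (_×_; _,_; proj₁; proj₂; ∃; uncurry)
open import Data.Sum using (_⊎_; inj₁; inj₂; [_,_]; [_,_]′)
open import Function.Base using (id)
open import Function.Bundles using (mk⇔)
open import Level using (Level)
open import Relation.Binary.Definitions using (tri<; tri≈; tri>)
open import Relation.Binary.PropositionalEquality
  using (_≡_; _≢_; refl; sym; trans; cong; cong₂; subst; subst₂; module ≡-Reasoning)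
open import Relation.Nullary using (¬_; yes; no; contradiction)
open import Relation.Nullary.Decidable using (_×-dec_)
open import Relation.Unary using (Pred; Decidable)
open import Relation.Unary.Properties using (∁?)

private variable
  a ℓ ℓ′ : Level
  X : Set a

module _ {P : Pred X ℓ} (P? : Decidable P) where

  length-filter-∁ : ∀ xs → length xs ≡ length (filter P? xs) + length (filter (∁? P?) xs)
  length-filter-∁ [] = refl
  length-filter-∁ (x ∷ xs) with P? x
  ... | yes _ = cong suc (length-filter-∁ xs)
  ... | no  _ = trans (cong suc (length-filter-∁ xs)) (sym (+-suc _ _))

  module _ {Q : Pred X ℓ′} (Q? : Decidable Q) where

    filter-×-dec : ∀ xs → filter (λ x → P? x ×-dec Q? x) xs ≡ filter Q? (filter P? xs)
    filter-×-dec [] = refl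
    filter-×-dec (x ∷ xs) with P? x
    ... | no  _ = filter-×-dec xs
    ... | yes _ with Q? x
    ...   | yes _ = cong (x ∷_) (filter-×-dec xs)
    ...   | no  _ = filter-×-dec xs

    length-filter-split : ∀ xs →
      length (filter Q? xs) ≡ length (filter Q? (filter P? xs)) + length (filter Q? (filter (∁? P?) xs))
    length-filter-split [] = refl
    length-filter-split (x ∷ xs) with P? x
    ... | yes _ with Q? x
    ...   | yes _ = cong suc (length-filter-split xs)
    ...   | no  _ = length-filter-split xs
    length-filter-split (x ∷ xs) | no _ with Q? x
    ...   | yes _ = trans (cong suc (length-filter-split xs)) (sym (+-suc _ _))
    ...   | no  _ = length-filter-split xs

unique∧sameElements⇒length≡ : {xs ys : List X} → Unique xs → Unique ys →
  (∀ {x} → x ∈ xs → x ∈ ys) → (∀ {x} → x ∈ ys → x ∈ xs) → length xs ≡ length ys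
unique∧sameElements⇒length≡ uxs uys xs⊆ys ys⊆xs =
  ↭-length (∼bag⇒↭ (unique∧set⇒bag uxs uys (mk⇔ xs⊆ys ys⊆xs)))

length-filter-only : {P : Pred X ℓ} (P? : Decidable P) {xs : List X} {x₀ : X} → Unique xs → x₀ ∈ xs → P x₀ →
  (∀ {x} → x ∈ xs → P x → x ≡ x₀) → length (filter P? xs) ≡ 1
length-filter-only P? uxs x₀∈xs Px₀ only = unique∧sameElements⇒length≡ (Unique.filter⁺ P? uxs) (All.[] ∷ [])
  (λ x∈ → here (uncurry only (∈-filter⁻ P? x∈)))
  (λ { (here refl) → ∈-filter⁺ P? x₀∈xs Px₀ })

length-filter-allBut : {P : Pred X ℓ} (P? : Decidable P) {xs : List X} {x₀ : X} → Unique xs → x₀ ∈ xs → ¬ P x₀ →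
  (∀ {x} → x ∈ xs → ¬ P x → x ≡ x₀) → length (filter P? xs) ≡ length xs ∸ 1
length-filter-allBut P? {xs} uxs x₀∈xs ¬Px₀ only = begin
  length (filter P? xs)                                    ≡⟨ m+n∸n≡m _ 1 ⟨
  length (filter P? xs) + 1 ∸ 1                            ≡⟨ cong (λ n → length (filter P? xs) + n ∸ 1) rest≡1 ⟨
  length (filter P? xs) + length (filter (∁? P?) xs) ∸ 1   ≡⟨ cong (_∸ 1) (length-filter-∁ P? xs) ⟨
  length xs ∸ 1                                            ∎
  where
  open ≡-Reasoning
  rest≡1 : length (filter (∁? P?) xs) ≡ 1
  rest≡1 = length-filter-only (∁? P?) uxs x₀∈xs ¬Px₀ only

-- Iterates and periods

private variable
  g : D → D
  x y z : D
  k m n : ℕ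

iter-+ : ∀ m n → iter g (m + n) x ≡ iter g m (iter g n x)
iter-+ zero    n = refl
iter-+ {g = g} (suc m) n = cong g (iter-+ m n)

iter-comm : ∀ m n → iter g m (iter g n x) ≡ iter g n (iter g m x)
iter-comm {g = g} {x = x} m n = begin
  iter g m (iter g n x) ≡⟨ iter-+ m n ⟨
  iter g (m + n) x      ≡⟨ cong (λ j → iter g j x) (+-comm m n) ⟩
  iter g (n + m) x      ≡⟨ iter-+ n m ⟩
  iter g n (iter g m x) ∎
  where open ≡-Reasoning

returns-* : iter g k x ≡ x → ∀ q → iter g (q * k) x ≡ x
returns-* e zero = refl
returns-* {g = g} {k = k} e (suc q) = trans (iter-+ k (q * k)) (trans (cong (iter g k) (returns-* e q)) e)

returns-% : .{{_ : NonZero k}} → iter g k x ≡ x → ∀ n → iter g n x ≡ iter g (n % k) x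
returns-% {k = k} {g = g} {x = x} e n = begin
  iter g n x                             ≡⟨ cong (λ j → iter g j x) (m≡m%n+[m/n]*n n k) ⟩
  iter g (n % k + (n / k) * k) x         ≡⟨ iter-+ (n % k) _ ⟩
  iter g (n % k) (iter g ((n / k) * k) x) ≡⟨ cong (iter g (n % k)) (returns-* e (n / k)) ⟩
  iter g (n % k) x                       ∎
  where open ≡-Reasoning

returns-forward : iter g m x ≡ x → ∀ a → iter g m (iter g a x) ≡ iter g a x
returns-forward {g = g} {m = m} e a = trans (iter-comm m a) (cong (iter g a) e)

module _ (g : D → D) where

  hasPeriod⇒returns : HasPeriod g k x → iter g k x ≡ x
  hasPeriod⇒returns {k = suc _} (e , _) = e

  hasPeriod⇒∣ : HasPeriod g k x → iter g m x ≡ x → k ∣ m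
  hasPeriod⇒∣ {k = suc k′} {x = x} {m = m} (e , noEarlier) ret
    with m % suc k′ in eq | m%n<n m (suc k′)
  ... | zero  | _        = m%n≡0⇒n∣m m (suc k′) eq
  ... | suc r | s≤s r<k′ = contradiction early (noEarlier (fromℕ< r<k′))
    where
    early : iter g (suc (toℕ (fromℕ< r<k′))) x ≡ x
    early = begin
      iter g (suc (toℕ (fromℕ< r<k′))) x ≡⟨ cong (λ j → iter g (suc j) x) (toℕ-fromℕ< r<k′) ⟩
      iter g (suc r) x                   ≡⟨ cong (λ j → iter g j x) eq ⟨
      iter g (m % suc k′) x              ≡⟨ returns-% e m ⟨
      iter g m x                         ≡⟨ ret ⟩
      x                                  ∎
      where open ≡-Reasoning

  returns∧∣⇒hasPeriod : 0 < k → iter g k x ≡ x → (∀ m → iter g m x ≡ x → k ∣ m) → HasPeriod g k x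
  returns∧∣⇒hasPeriod {k = suc k′} _ e k∣ =
    e , λ m ret → <-irrefl refl (<-≤-trans (s≤s (toℕ<n m)) (∣⇒≤ (k∣ (suc (toℕ m)) ret)))

  hasPeriod-unique : HasPeriod g k x → HasPeriod g m x → k ≡ m
  hasPeriod-unique hk hm =
    ∣-antisym (hasPeriod⇒∣ hk (hasPeriod⇒returns hm)) (hasPeriod⇒∣ hm (hasPeriod⇒returns hk))

  fixed⇒hasPeriod1 : g x ≡ x → HasPeriod g 1 x
  fixed⇒hasPeriod1 e = e , λ ()

  hasPeriod⇒iter-inverse : HasPeriod g (suc k) x → ∀ a → iter g (a * k) (iter g a x) ≡ x
  hasPeriod⇒iter-inverse {k = k} {x = x} hx a = begin
    iter g (a * k) (iter g a x) ≡⟨ iter-+ (a * k) a ⟨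
    iter g (a * k + a) x        ≡⟨ cong (λ j → iter g j x) (trans (+-comm (a * k) a) (sym (*-suc a k))) ⟩
    iter g (a * suc k) x        ≡⟨ returns-* (hasPeriod⇒returns hx) a ⟩
    x                           ∎
    where open ≡-Reasoning

  hasPeriod-iter : HasPeriod g k x → ∀ a → HasPeriod g k (iter g a x)
  hasPeriod-iter {k = suc k′} {x = x} hx a =
    returns∧∣⇒hasPeriod (s≤s z≤n) (returns-forward {m = suc k′} (hasPeriod⇒returns hx) a) λ m ret →
      hasPeriod⇒∣ hx (begin
        iter g m x                                ≡⟨ cong (iter g m) (hasPeriod⇒iter-inverse hx a) ⟨
        iter g m (iter g (a * k′) (iter g a x))   ≡⟨ iter-comm m (a * k′) ⟩
        iter g (a * k′) (iter g m (iter g a x))   ≡⟨ cong (iter g (a * k′)) ret ⟩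
        iter g (a * k′) (iter g a x)              ≡⟨ hasPeriod⇒iter-inverse hx a ⟩
        x                                         ∎)
    where open ≡-Reasoning

-- Orbits and cycle counts

code-injective : code x ≡ code y → x ≡ y
code-injective {rot i} {rot j} e = cong rot (*-cancelˡ-≡ i j 2 e)
code-injective {rot i} {ref j} e = ⊥-elim (even≢odd i j e)
code-injective {ref i} {rot j} e = ⊥-elim (even≢odd j i (sym e))
code-injective {ref i} {ref j} e = cong ref (*-cancelˡ-≡ i j 2 (suc-injective e))

Closed : (D → D) → List D → Set
Closed g L = ∀ {x} → x ∈ L → g x ∈ L

orbit : (D → D) → ℕ → D → List D
orbit g k x = tabulate {n = k} (λ m → iter g (toℕ m) x)

periodCount : (D → D) → ℕ → List D → ℕ
periodCount g k L = length (filter (hasPeriod? g k) L)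

module _ (g : D → D) where

  ∈orbit⁻ : y ∈ orbit g k x → ∃ λ (m : Fin k) → y ≡ iter g (toℕ m) x
  ∈orbit⁻ {x = x} = ∈-tabulate⁻ {f = λ m → iter g (toℕ m) x}

  iter∈orbit : HasPeriod g k x → ∀ n → iter g n x ∈ orbit g k x
  iter∈orbit {k = suc k′} {x = x} hx n =
    subst (_∈ orbit g (suc k′) x) same (∈-tabulate⁺ {f = λ m → iter g (toℕ m) x} r)
    where
    r : Fin (suc k′)
    r = fromℕ< (m%n<n n (suc k′))
    same : iter g (toℕ r) x ≡ iter g n x
    same = trans (cong (λ j → iter g j x) (toℕ-fromℕ< (m%n<n n (suc k′))))
                 (sym (returns-% {k = suc k′} (hasPeriod⇒returns g hx) n))

  ∈orbit-iter : HasPeriod g k x → y ∈ orbit g k x → ∀ n → iter g n y ∈ orbit g k x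
  ∈orbit-iter {k = k} {x = x} hx y∈ n with ∈orbit⁻ y∈
  ... | m , refl = subst (_∈ orbit g k x) (iter-+ n (toℕ m)) (iter∈orbit hx (n + toℕ m))

  ∈orbit⇒hasPeriod : HasPeriod g k x → y ∈ orbit g k x → HasPeriod g k y
  ∈orbit⇒hasPeriod hx y∈ with ∈orbit⁻ y∈
  ... | m , refl = hasPeriod-iter g hx (toℕ m)

  orbit-sym : HasPeriod g k x → y ∈ orbit g k x → x ∈ orbit g k y
  orbit-sym {k = suc k′} {x = x} {y = y} hx y∈ with ∈orbit⁻ y∈
  ... | a , refl = subst (_∈ orbit g (suc k′) y) (hasPeriod⇒iter-inverse g hx (toℕ a))
                         (iter∈orbit (∈orbit⇒hasPeriod hx y∈) (toℕ a * k′))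

  orbit-shift : HasPeriod g k x → y ∈ orbit g k x → z ∈ orbit g k x → z ∈ orbit g k y
  orbit-shift hx y∈ z∈ with ∈orbit⁻ z∈
  ... | b , refl = ∈orbit-iter (∈orbit⇒hasPeriod hx y∈) (orbit-sym hx y∈) (toℕ b)

  iter-injective : HasPeriod g k x → ∀ {i j} → i < j → j < k → iter g i x ≢ iter g j x
  iter-injective {k = k} {x = x} hx {i} {j} i<j j<k e = <-irrefl refl (begin-strict
    k     ≤⟨ ∣⇒≤ {{>-nonZero (m<n⇒0<n∸m i<j)}} (hasPeriod⇒∣ g (hasPeriod-iter g hx i) returns) ⟩
    j ∸ i ≤⟨ m∸n≤m j i ⟩
    j     <⟨ j<k ⟩
    k     ∎)
    where
    open ≤-Reasoning
    returns : iter g (j ∸ i) (iter g i x) ≡ iter g i x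
    returns = trans (sym (iter-+ (j ∸ i) i)) (trans (cong (λ n → iter g n x) (m∸n+n≡m (<⇒≤ i<j))) (sym e))

  orbit-unique : HasPeriod g k x → Unique (orbit g k x)
  orbit-unique {k = k} {x = x} hx =
    Unique.tabulate⁺ λ {i} {j} e → toℕ-injective (case-split (toℕ i) (toℕ j) (toℕ<n i) (toℕ<n j) e)
    where
    case-split : ∀ i j → i < k → j < k → iter g i x ≡ iter g j x → i ≡ j
    case-split i j i<k j<k e with <-cmp i j
    ... | tri< i<j _ _ = contradiction e (iter-injective hx i<j j<k)
    ... | tri≈ _ i≡j _ = i≡j
    ... | tri> _ _ j<i = contradiction (sym e) (iter-injective hx j<i i<k)

  g∈orbit⇒∈orbit : HasPeriod g k x → HasPeriod g k y → g y ∈ orbit g k x → y ∈ orbit g k x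
  g∈orbit⇒∈orbit {k = suc k′} {x = x} hx hy gy∈ =
    subst (_∈ orbit g (suc k′) x) (trans (sym (iter-comm 1 k′)) (hasPeriod⇒returns g hy))
          (∈orbit-iter hx gy∈ k′)

  isRep⇒≤ : IsRep g k y → z ∈ orbit g k y → code y ≤ code z
  isRep⇒≤ rep z∈ with ∈orbit⁻ z∈
  ... | m , refl = rep m

  orbitRep : ℕ → D → D
  orbitRep k x = argmin code x (orbit g k x)

  orbitRep∈orbit : HasPeriod g k x → orbitRep k x ∈ orbit g k x
  orbitRep∈orbit {k = k} {x = x} hx with argmin-sel code x (orbit g k x)
  ... | inj₁ rep≡x = subst (_∈ orbit g k x) (sym rep≡x) (iter∈orbit hx 0)
  ... | inj₂ rep∈  = rep∈

  orbitRep-isRep : HasPeriod g k x → IsRep g k (orbitRep k x)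
  orbitRep-isRep {k = k} {x = x} hx m =
    All.lookup (f[argmin]≤f[xs] {f = code} x (orbit g k x)) (∈orbit-iter hx (orbitRep∈orbit hx) (toℕ m))

  isRep-unique : HasPeriod g k x → y ∈ orbit g k x → z ∈ orbit g k x → IsRep g k y → IsRep g k z → y ≡ z
  isRep-unique hx y∈ z∈ repy repz =
    code-injective (≤-antisym (isRep⇒≤ repy (orbit-shift hx y∈ z∈)) (isRep⇒≤ repz (orbit-shift hx z∈ y∈)))

  closed⇒iter∈ : {L : List D} → Closed g L → x ∈ L → ∀ n → iter g n x ∈ L
  closed⇒iter∈ closed x∈ zero    = x∈
  closed⇒iter∈ closed x∈ (suc n) = closed (closed⇒iter∈ closed x∈ n)

  module _ {h : D → D} (h∘g≗g∘h : ∀ y → h (g y) ≡ g (h y)) where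

    iter-conj : ∀ m y → h (iter g m y) ≡ iter g m (h y)
    iter-conj zero    y = refl
    iter-conj (suc m) y = trans (h∘g≗g∘h (iter g m y)) (cong g (iter-conj m y))

    hasPeriod-conj : {S : List D} → Closed g S → (∀ {y y′} → y ∈ S → y′ ∈ S → h y ≡ h y′ → y ≡ y′) →
      x ∈ S → HasPeriod g k (h x) → HasPeriod g k x
    hasPeriod-conj {x = x} {k = suc k′} closed h-inj x∈ hhx = returns∧∣⇒hasPeriod g (s≤s z≤n)
      (h-inj (closed⇒iter∈ closed x∈ (suc k′)) x∈ (trans (iter-conj (suc k′) x) (hasPeriod⇒returns g hhx)))
      (λ m ret → hasPeriod⇒∣ g hhx (trans (sym (iter-conj m x)) (cong h ret)))

  module _ {k : ℕ} {L : List D} (uniq : Unique L) (closed : Closed g L)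
           (periodic : ∀ {y} → y ∈ L → HasPeriod g k y) {x : D} (x∈L : x ∈ L) where

    private
      hx : HasPeriod g k x
      hx = periodic x∈L

      inOrbit? : Decidable (_∈ orbit g k x)
      inOrbit? = _∈? orbit g k x

      orbit⊆L : y ∈ orbit g k x → y ∈ L
      orbit⊆L y∈ with ∈orbit⁻ y∈
      ... | m , refl = closed⇒iter∈ closed x∈L (toℕ m)

    length-filter-∈orbit : length (filter inOrbit? L) ≡ k
    length-filter-∈orbit = trans
      (unique∧sameElements⇒length≡ (Unique.filter⁺ inOrbit? uniq) (orbit-unique hx)
        (λ y∈ → proj₂ (∈-filter⁻ inOrbit? {xs = L} y∈)) (λ y∈ → ∈-filter⁺ inOrbit? (orbit⊆L y∈) y∈))
      (length-tabulate _)

    length-filter-isRep-∈orbit : length (filter (isRep? g k) (filter inOrbit? L)) ≡ 1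
    length-filter-isRep-∈orbit =
      length-filter-only (isRep? g k) (Unique.filter⁺ inOrbit? uniq)
        (∈-filter⁺ inOrbit? (orbit⊆L (orbitRep∈orbit hx)) (orbitRep∈orbit hx)) (orbitRep-isRep hx)
        λ y∈ repy → isRep-unique hx (proj₂ (∈-filter⁻ inOrbit? {xs = L} y∈)) (orbitRep∈orbit hx)
                                 repy (orbitRep-isRep hx)

    closed-∉orbit : Closed g (filter (∁? inOrbit?) L)
    closed-∉orbit y∈ with ∈-filter⁻ (∁? inOrbit?) y∈
    ... | y∈L , y∉ =
      ∈-filter⁺ (∁? inOrbit?) (closed y∈L) λ gy∈ → y∉ (g∈orbit⇒∈orbit hx (periodic y∈L) gy∈)

  reps*period≡length : ∀ {k} {L : List D} → Unique L → Closed g L → (∀ {y} → y ∈ L → HasPeriod g k y) →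
    length (filter (isRep? g k) L) * k ≡ length L
  reps*period≡length {L = L} = go (length L) ≤-refl
    where
    go : ∀ {k} n {L : List D} → length L ≤ n → Unique L → Closed g L → (∀ {y} → y ∈ L → HasPeriod g k y) →
      length (filter (isRep? g k) L) * k ≡ length L
    go _ {[]} _ _ _ _ = refl
    go {k} (suc n) {L@(x ∷ L′)} (s≤s len) uniq closed periodic = begin
      length (filter R? L) * k
        ≡⟨ cong (_* k) (length-filter-split O? R? L) ⟩
      (length (filter R? (filter O? L)) + length (filter R? rest)) * k
        ≡⟨ cong (λ r → (r + length (filter R? rest)) * k)
                (length-filter-isRep-∈orbit uniq closed periodic x∈L) ⟩
      k + length (filter R? rest) * k
        ≡⟨ cong₂ _+_ (length-filter-∈orbit uniq closed periodic x∈L)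
                     (sym (go n restShorter (Unique.filter⁺ (∁? O?) uniq) (closed-∉orbit uniq closed periodic x∈L)
                              (λ y∈ → periodic (proj₁ (∈-filter⁻ (∁? O?) y∈))))) ⟨
      length (filter O? L) + length rest
        ≡⟨ length-filter-∁ O? L ⟨
      length L ∎
      where
      open ≡-Reasoning
      R? : Decidable (IsRep g k)
      R? = isRep? g k
      O? : Decidable (_∈ orbit g k x)
      O? = _∈? orbit g k x
      x∈L : x ∈ L
      x∈L = here refl
      rest : List D
      rest = filter (∁? O?) L
      restShorter : length rest ≤ n
      restShorter = subst (λ r → length r ≤ n)
        (sym (filter-reject (∁? O?) (λ x∉ → x∉ (iter∈orbit (periodic x∈L) 0))))
        (≤-trans (length-filter (∁? O?) L′) len)

  cycleCount*k≡periodCount : ∀ {k} {L : List D} → Unique L → Closed g L →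
    length (filter (λ y → hasPeriod? g k y ×-dec isRep? g k y) L) * k ≡ periodCount g k L
  cycleCount*k≡periodCount {k} {L} uniq closed = begin
    length (filter (λ y → hasPeriod? g k y ×-dec isRep? g k y) L) * k
      ≡⟨ cong (λ r → length r * k) (filter-×-dec (hasPeriod? g k) (isRep? g k) L) ⟩
    length (filter (isRep? g k) (filter (hasPeriod? g k) L)) * k
      ≡⟨ reps*period≡length (Unique.filter⁺ (hasPeriod? g k) uniq) closedPeriodic
                            (λ y∈ → proj₂ (∈-filter⁻ (hasPeriod? g k) {xs = L} y∈)) ⟩
    periodCount g k L ∎
    where
    open ≡-Reasoning
    closedPeriodic : Closed g (filter (hasPeriod? g k) L)
    closedPeriodic y∈ with ∈-filter⁻ (hasPeriod? g k) {xs = L} y∈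
    ... | y∈L , hy = ∈-filter⁺ (hasPeriod? g k) (closed y∈L) (hasPeriod-iter g hy 1)

  periodCount-++ : ∀ {k} L L′ → periodCount g k (L ++ L′) ≡ periodCount g k L + periodCount g k L′
  periodCount-++ {k} L L′ =
    trans (cong length (filter-++ (hasPeriod? g k) L L′)) (length-++ (filter (hasPeriod? g k) L))

  periodCount≡0 : ∀ {k} {L : List D} → (∀ {y} → y ∈ L → ¬ HasPeriod g k y) → periodCount g k L ≡ 0
  periodCount≡0 {k} none = cong length (filter-none (hasPeriod? g k) (All.tabulate none))

  module _ {c : ℕ} {L : List D} (periodic : ∀ {y} → y ∈ L → HasPeriod g c y) where

    periodCount-uniform : periodCount g c L ≡ length L
    periodCount-uniform = cong length (filter-all (hasPeriod? g c) (All.tabulate periodic))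

    periodCount-uniform-≢ : k ≢ c → periodCount g k L ≡ 0
    periodCount-uniform-≢ k≢c = periodCount≡0 λ y∈ hk → k≢c (hasPeriod-unique g hk (periodic y∈))

  module _ {L : List D} (uniq : Unique L) {x₀ : D} (x₀∈L : x₀ ∈ L) (fixed : HasPeriod g 1 x₀)
           {c : ℕ} (c≢1 : c ≢ 1) (others : ∀ {y} → y ∈ L → y ≡ x₀ ⊎ HasPeriod g c y) where

    periodCount-fixed : periodCount g 1 L ≡ 1
    periodCount-fixed = length-filter-only (hasPeriod? g 1) uniq x₀∈L fixed λ y∈ h1 →
      [ id , (λ hc → contradiction (hasPeriod-unique g hc h1) c≢1) ] (others y∈)

    periodCount-others : periodCount g c L ≡ length L ∸ 1
    periodCount-others = length-filter-allBut (hasPeriod? g c) uniq x₀∈L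
      (λ hc → c≢1 (hasPeriod-unique g hc fixed))
      λ y∈ ¬hc → [ id , (λ hc → contradiction hc ¬hc) ] (others y∈)

    periodCount-neither : k ≢ 1 → k ≢ c → periodCount g k L ≡ 0
    periodCount-neither k≢1 k≢c = periodCount≡0 λ y∈ hk →
      [ (λ { refl → k≢1 (hasPeriod-unique g hk fixed) }) , (λ hc → k≢c (hasPeriod-unique g hk hc)) ]
        (others y∈)

-- Arithmetic modulo a prime

suc<⇒<∸1 : suc m < n → m < n ∸ 1
suc<⇒<∸1 {n = suc _} (s≤s m<n) = m<n

<∸1⇒suc< : m < n ∸ 1 → suc m < n
<∸1⇒suc< {n = suc _} m<n = s≤s m<n

n∸1+n≡2*n∸1 : 0 < n → n ∸ 1 + n ≡ 2 * n ∸ 1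
n∸1+n≡2*n∸1 {suc n} _ = cong (n +_) (sym (+-identityʳ (suc n)))

injective⇒surjective : ∀ n (f : ℕ → ℕ) → (∀ {x} → x < n → f x < n) →
  (∀ {x y} → x < n → y < n → f x ≡ f y → x ≡ y) → ∀ {y} → y < n → ∃ λ x → x < n × f x ≡ y
injective⇒surjective (suc n) f f< f-inj {y} y<n with any? {n = suc n} (λ i → f (toℕ i) ≟ y)
... | yes (i , fi≡y) = toℕ i , toℕ<n i , fi≡y
... | no  ∄preimage  = contradiction (injective⇒≤ {f = F} F-injective) (<-irrefl refl)
  where
  y≢f : ∀ i → fromℕ< y<n ≢ fromℕ< (f< (toℕ<n i))
  y≢f i e = ∄preimage (i , sym (fromℕ<-injective _ _ y<n (f< (toℕ<n i)) e))
  F : Fin (suc n) → Fin n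
  F i = punchOut (y≢f i)
  F-injective : ∀ {i j} → F i ≡ F j → i ≡ j
  F-injective {i} {j} e = toℕ-injective (f-inj (toℕ<n i) (toℕ<n j)
    (fromℕ<-injective _ _ (f< (toℕ<n i)) (f< (toℕ<n j)) (punchOut-injective (y≢f i) (y≢f j) e)))

module _ (d : ℕ) .{{_ : NonZero d}} where

  [m*[n%d]]%d≡[m*n]%d : ∀ m n → (m * (n % d)) % d ≡ (m * n) % d
  [m*[n%d]]%d≡[m*n]%d m n = begin
    (m * (n % d)) % d             ≡⟨ %-distribˡ-* m (n % d) d ⟩
    ((m % d) * (n % d % d)) % d   ≡⟨ cong (λ r → ((m % d) * r) % d) (m%n%n≡m%n n d) ⟩
    ((m % d) * (n % d)) % d       ≡⟨ %-distribˡ-* m n d ⟨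
    (m * n) % d                   ∎
    where open ≡-Reasoning

  [[m%d]*n]%d≡[m*n]%d : ∀ m n → ((m % d) * n) % d ≡ (m * n) % d
  [[m%d]*n]%d≡[m*n]%d m n = trans (cong (_% d) (*-comm (m % d) n))
                                  (trans ([m*[n%d]]%d≡[m*n]%d n m) (cong (_% d) (*-comm n m)))

  [[m%d]+n]%d≡[m+n]%d : ∀ m n → (m % d + n) % d ≡ (m + n) % d
  [[m%d]+n]%d≡[m+n]%d m n = begin
    (m % d + n) % d           ≡⟨ %-distribˡ-+ (m % d) n d ⟩
    (m % d % d + n % d) % d   ≡⟨ cong (λ r → (r + n % d) % d) (m%n%n≡m%n m d) ⟩
    (m % d + n % d) % d       ≡⟨ %-distribˡ-+ m n d ⟨
    (m + n) % d               ∎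
    where open ≡-Reasoning

  [[m%d]^n]%d≡[m^n]%d : ∀ m n → ((m % d) ^ n) % d ≡ (m ^ n) % d
  [[m%d]^n]%d≡[m^n]%d m zero    = refl
  [[m%d]^n]%d≡[m^n]%d m (suc n) = begin
    ((m % d) * (m % d) ^ n) % d         ≡⟨ [m*[n%d]]%d≡[m*n]%d (m % d) _ ⟨
    ((m % d) * ((m % d) ^ n % d)) % d   ≡⟨ cong (λ r → ((m % d) * r) % d) ([[m%d]^n]%d≡[m^n]%d m n) ⟩
    ((m % d) * (m ^ n % d)) % d         ≡⟨ [m*[n%d]]%d≡[m*n]%d (m % d) _ ⟩
    ((m % d) * m ^ n) % d               ≡⟨ [[m%d]*n]%d≡[m*n]%d m _ ⟩
    (m * m ^ n) % d                     ∎
    where open ≡-Reasoning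

  ^-%-periodic : ∀ m k .{{_ : NonZero k}} → m ^ k % d ≡ 1 % d → ∀ n → m ^ n % d ≡ m ^ (n % k) % d
  ^-%-periodic m k m^k≡1 n = begin
    m ^ n % d                                   ≡⟨ cong (λ r → m ^ r % d) (m≡m%n+[m/n]*n n k) ⟩
    m ^ (n % k + n / k * k) % d                 ≡⟨ cong (_% d) (^-distribˡ-+-* m (n % k) _) ⟩
    (m ^ (n % k) * m ^ (n / k * k)) % d         ≡⟨ [m*[n%d]]%d≡[m*n]%d (m ^ (n % k)) _ ⟨
    (m ^ (n % k) * (m ^ (n / k * k) % d)) % d   ≡⟨ cong (λ r → (m ^ (n % k) * r) % d) full≡1 ⟩
    (m ^ (n % k) * (1 % d)) % d                 ≡⟨ [m*[n%d]]%d≡[m*n]%d (m ^ (n % k)) 1 ⟩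
    (m ^ (n % k) * 1) % d                       ≡⟨ cong (_% d) (*-identityʳ _) ⟩
    m ^ (n % k) % d                             ∎
    where
    open ≡-Reasoning
    full≡1 : m ^ (n / k * k) % d ≡ 1 % d
    full≡1 = begin
      m ^ (n / k * k) % d      ≡⟨ cong (λ r → m ^ r % d) (*-comm (n / k) k) ⟩
      m ^ (k * (n / k)) % d    ≡⟨ cong (_% d) (^-*-assoc m k (n / k)) ⟨
      (m ^ k) ^ (n / k) % d    ≡⟨ [[m%d]^n]%d≡[m^n]%d (m ^ k) (n / k) ⟨
      (m ^ k % d) ^ (n / k) % d ≡⟨ cong (λ r → r ^ (n / k) % d) m^k≡1 ⟩
      (1 % d) ^ (n / k) % d    ≡⟨ [[m%d]^n]%d≡[m^n]%d 1 (n / k) ⟩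
      1 ^ (n / k) % d          ≡⟨ cong (_% d) (^-zeroˡ (n / k)) ⟩
      1 % d                    ∎

  %≡%⇒∣∸ : ∀ {m n} → m ≤ n → m % d ≡ n % d → d ∣ n ∸ m
  %≡%⇒∣∸ {m} {n} m≤n e = divides (n / d ∸ m / d) (begin
    n ∸ m                                         ≡⟨ cong₂ _∸_ (m≡m%n+[m/n]*n n d) (m≡m%n+[m/n]*n m d) ⟩
    (n % d + n / d * d) ∸ (m % d + m / d * d)     ≡⟨ cong (λ r → (n % d + n / d * d) ∸ (r + m / d * d)) e ⟩
    (n % d + n / d * d) ∸ (n % d + m / d * d)     ≡⟨ [m+n]∸[m+o]≡n∸o (n % d) _ _ ⟩
    n / d * d ∸ m / d * d                         ≡⟨ *-distribʳ-∸ d (n / d) (m / d) ⟨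
    (n / d ∸ m / d) * d                           ∎)
    where open ≡-Reasoning

  ∣∸⇒%≡% : ∀ {m n} → m ≤ n → d ∣ n ∸ m → m % d ≡ n % d
  ∣∸⇒%≡% {m} {n} m≤n (divides q n∸m≡q*d) = sym (begin
    n % d               ≡⟨ cong (_% d) (m+[n∸m]≡n m≤n) ⟨
    (m + (n ∸ m)) % d   ≡⟨ cong (λ r → (m + r) % d) n∸m≡q*d ⟩
    (m + q * d) % d     ≡⟨ [m+kn]%n≡m%n m q d ⟩
    m % d               ∎)
    where open ≡-Reasoning

  +-cancelʳ-% : ∀ o {m n} → (m + o) % d ≡ (n + o) % d → m % d ≡ n % d
  +-cancelʳ-% o {m} {n} e =
    [ (λ m≤n → cancel≤ m≤n e) , (λ n≤m → sym (cancel≤ n≤m (sym e))) ]′ (≤-total m n)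
    where
    cancel≤ : ∀ {m n} → m ≤ n → (m + o) % d ≡ (n + o) % d → m % d ≡ n % d
    cancel≤ {m} {n} m≤n e = ∣∸⇒%≡% m≤n (subst (d ∣_) ([m+n]∸[m+o]≡n∸o o n m)
      (subst₂ (λ a b → d ∣ a ∸ b) (+-comm n o) (+-comm m o) (%≡%⇒∣∸ (+-monoˡ-≤ o m≤n) e)))

module _ {p : ℕ} .{{_ : NonZero p}} (p-prime : Prime p) where

  1<p : 1 < p
  1<p = nonTrivial⇒n>1 p {{prime⇒nonTrivial p-prime}}

  ∤-* : p ∤ m → p ∤ n → p ∤ m * n
  ∤-* {m} {n} p∤m p∤n p∣mn = [ p∤m , p∤n ]′ (euclidsLemma m n p-prime p∣mn)

  ∤-^ : p ∤ m → ∀ n → p ∤ m ^ n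
  ∤-^ p∤m zero    p∣1 = <-irrefl (sym (∣1⇒≡1 p∣1)) 1<p
  ∤-^ p∤m (suc n) = ∤-* p∤m (∤-^ p∤m n)

  *-cancelˡ-% : ∀ {m} → p ∤ m → ∀ {n o} → (m * n) % p ≡ (m * o) % p → n % p ≡ o % p
  *-cancelˡ-% {m} p∤m {n} {o} e =
    [ (λ n≤o → cancel≤ n≤o e) , (λ o≤n → sym (cancel≤ o≤n (sym e))) ]′ (≤-total n o)
    where
    cancel≤ : ∀ {n o} → n ≤ o → (m * n) % p ≡ (m * o) % p → n % p ≡ o % p
    cancel≤ {n} {o} n≤o e = ∣∸⇒%≡% p n≤o ([ (λ p∣m → contradiction p∣m p∤m) , id ]′
      (euclidsLemma m (o ∸ n) p-prime
        (subst (p ∣_) (sym (*-distribˡ-∸ m o n)) (%≡%⇒∣∸ p (*-monoʳ-≤ m n≤o) e))))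

∤⇒0<% : .{{_ : NonZero n}} → n ∤ m → 0 < m % n
∤⇒0<% {n} {m} n∤m = n≢0⇒n>0 (λ m%n≡0 → n∤m (m%n≡0⇒n∣m m n m%n≡0))

-- The order of z ^ i for a primitive root z

module _ (i n : ℕ) .{{_ : NonZero n}} where

  private
    i∣ : gcd i n ∣ i
    i∣ = gcd[m,n]∣m i n
    n∣ : gcd i n ∣ n
    n∣ = gcd[m,n]∣n i n
    d : ℕ
    d = gcd i n
    i′ : ℕ
    i′ = _∣_.quotient i∣
    n′ : ℕ
    n′ = _∣_.quotient n∣

    instance
      d≢0 : NonZero d
      d≢0 = ≢-nonZero (λ d≡0 → ≢-nonZero⁻¹ n (gcd[m,n]≡0⇒n≡0 i d≡0))

    coprime : Coprime n′ i′
    coprime {c} (c∣n′ , c∣i′) = ∣1⇒≡1 (*-cancelʳ-∣ d (subst (c * d ∣_) (sym (*-identityˡ d))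
      (gcd-greatest (subst (c * d ∣_) (sym (_∣_.equality i∣)) (*-monoˡ-∣ d c∣i′))
                    (subst (c * d ∣_) (sym (_∣_.equality n∣)) (*-monoˡ-∣ d c∣n′)))))

  n/gcd∣m⇒n∣i*m : ∀ {m} → _∣_.quotient (gcd[m,n]∣n i n) ∣ m → n ∣ i * m
  n/gcd∣m⇒n∣i*m (divides r refl) = divides (i′ * r) (begin
    i * (r * n′)         ≡⟨ cong (_* (r * n′)) (_∣_.equality i∣) ⟩
    i′ * d * (r * n′)    ≡⟨ rearrange i′ d r n′ ⟩
    i′ * r * (n′ * d)    ≡⟨ cong ((i′ * r) *_) (_∣_.equality n∣) ⟨
    i′ * r * n           ∎)
    where
    open ≡-Reasoning
    rearrange : ∀ a b c e → a * b * (c * e) ≡ a * c * (e * b)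
    rearrange = solve-∀

  n∣i*m⇒n/gcd∣m : ∀ {m} → n ∣ i * m → _∣_.quotient (gcd[m,n]∣n i n) ∣ m
  n∣i*m⇒n/gcd∣m {m} (divides q i*m≡q*n) =
    coprime-divisor coprime (divides q (*-cancelʳ-≡ (i′ * m) (q * n′) d (begin
    i′ * m * d      ≡⟨ *-assoc i′ m d ⟩
    i′ * (m * d)    ≡⟨ cong (i′ *_) (*-comm m d) ⟩
    i′ * (d * m)    ≡⟨ *-assoc i′ d m ⟨
    i′ * d * m      ≡⟨ cong (_* m) (_∣_.equality i∣) ⟨
    i * m           ≡⟨ i*m≡q*n ⟩
    q * n           ≡⟨ cong (q *_) (_∣_.equality n∣) ⟩
    q * (n′ * d)    ≡⟨ *-assoc q n′ d ⟨
    q * n′ * d      ∎)))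
    where open ≡-Reasoning

module PrimitiveRoot {p : ℕ} .{{_ : NonZero p}} (p-prime : Prime p) {z : ℕ} (gen : IsGenerator p z) where

  instance
    p∸1≢0 : NonZero (p ∸ 1)
    p∸1≢0 = >-nonZero (m<n⇒0<n∸m (1<p p-prime))

  1%p≡1 : 1 % p ≡ 1
  1%p≡1 = m<n⇒m%n≡m (1<p p-prime)

  p∤z^ : ∀ n → p ∤ z ^ n
  p∤z^ = ∤-^ p-prime (>⇒∤ {{>-nonZero (proj₁ (proj₁ gen))}} (proj₂ (proj₁ gen)))

  -- Every unit is z ^ (l % e) for its logarithm l, so the logarithm mod e is injective on the p - 1 units.
  order-≥ : ∀ {e} → 0 < e → z ^ e % p ≡ 1 → p ∸ 1 ≤ e
  order-≥ {e} 0<e z^e≡1 = injective⇒≤ {f = logMod} logMod-injective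
    where
    instance
      e≢0 : NonZero e
      e≢0 = >-nonZero 0<e
    log : Fin (p ∸ 1) → ℕ
    log u = proj₁ (proj₂ gen (suc (toℕ u)) (s≤s z≤n , <∸1⇒suc< (toℕ<n u)))
    z^log : ∀ u → z ^ log u % p ≡ suc (toℕ u)
    z^log u = proj₂ (proj₂ (proj₂ gen (suc (toℕ u)) (s≤s z≤n , <∸1⇒suc< (toℕ<n u))))
    logMod : Fin (p ∸ 1) → Fin e
    logMod u = fromℕ< (m%n<n (log u) e)
    periodic : ∀ n → z ^ n % p ≡ z ^ (n % e) % p
    periodic = ^-%-periodic p z e (trans z^e≡1 (sym 1%p≡1))
    logMod-injective : ∀ {u v} → logMod u ≡ logMod v → u ≡ v
    logMod-injective {u} {v} eq = toℕ-injective (suc-injective (begin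
      suc (toℕ u)           ≡⟨ z^log u ⟨
      z ^ log u % p         ≡⟨ periodic (log u) ⟩
      z ^ (log u % e) % p   ≡⟨ cong (λ r → z ^ r % p) (fromℕ<-injective _ _ (m%n<n _ e) (m%n<n _ e) eq) ⟩
      z ^ (log v % e) % p   ≡⟨ periodic (log v) ⟨
      z ^ log v % p         ≡⟨ z^log v ⟩
      suc (toℕ v)           ∎))
      where open ≡-Reasoning

  z^[p∸1]%p≡1 : z ^ (p ∸ 1) % p ≡ 1
  z^[p∸1]%p≡1 with proj₂ gen (z ^ (p ∸ 1) % p) (∤⇒0<% (p∤z^ (p ∸ 1)) , m%n<n _ p)
  ... | zero  , _   , 1%p≡ = trans (sym 1%p≡) 1%p≡1
  ... | suc e , e<  , z^e≡ =
    contradiction (order-≥ (m<n⇒0<n∸m e<) z^rest≡1) (<⇒≱ (∸-monoʳ-< {o = 0} (s≤s z≤n) (<⇒≤ e<)))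
    where
    rest : ℕ
    rest = p ∸ 1 ∸ suc e
    z^rest≡1 : z ^ rest % p ≡ 1
    z^rest≡1 = trans (*-cancelˡ-% p-prime (p∤z^ (suc e)) (begin
      (z ^ suc e * z ^ rest) % p   ≡⟨ cong (_% p) (^-distribˡ-+-* z (suc e) rest) ⟨
      z ^ (suc e + rest) % p       ≡⟨ cong (λ r → z ^ r % p) (m+[n∸m]≡n (<⇒≤ e<)) ⟩
      z ^ (p ∸ 1) % p              ≡⟨ z^e≡ ⟨
      z ^ suc e % p                ≡⟨ cong (_% p) (*-identityʳ _) ⟨
      (z ^ suc e * 1) % p          ∎)) 1%p≡1
      where open ≡-Reasoning

  z^n%p≡1⇒p∸1∣n : ∀ {n} → z ^ n % p ≡ 1 → p ∸ 1 ∣ n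
  z^n%p≡1⇒p∸1∣n {n} z^n≡1 with n % (p ∸ 1) in eq
  ... | zero  = m%n≡0⇒n∣m n (p ∸ 1) eq
  ... | suc r = contradiction (order-≥ (s≤s z≤n) z^r′≡1) (<⇒≱ (subst (_< p ∸ 1) eq (m%n<n n (p ∸ 1))))
    where
    z^r′≡1 : z ^ suc r % p ≡ 1
    z^r′≡1 = trans (cong (λ j → z ^ j % p) (sym eq))
      (trans (sym (^-%-periodic p z (p ∸ 1) (trans z^[p∸1]%p≡1 (sym 1%p≡1)) n)) z^n≡1)

  p∸1∣n⇒z^n%p≡1 : ∀ {n} → p ∸ 1 ∣ n → z ^ n % p ≡ 1
  p∸1∣n⇒z^n%p≡1 {n} p∸1∣n = begin
    z ^ n % p               ≡⟨ ^-%-periodic p z (p ∸ 1) (trans z^[p∸1]%p≡1 (sym 1%p≡1)) n ⟩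
    z ^ (n % (p ∸ 1)) % p   ≡⟨ cong (λ j → z ^ j % p) (n∣m⇒m%n≡0 n (p ∸ 1) p∸1∣n) ⟩
    1 % p                   ≡⟨ 1%p≡1 ⟩
    1                       ∎
    where open ≡-Reasoning

  0<cycLen : ∀ i → 0 < cycLen p i
  0<cycLen i = >-nonZero⁻¹ _ {{quotient≢0 (gcd[m,n]∣n i (p ∸ 1))}}

  module _ {s : ℕ} (i : ℕ) (z^i≡s : z ^ i % p ≡ s) where

    s^m%p≡z^[i*m]%p : ∀ m → s ^ m % p ≡ z ^ (i * m) % p
    s^m%p≡z^[i*m]%p m = begin
      s ^ m % p             ≡⟨ cong (λ r → r ^ m % p) z^i≡s ⟨
      (z ^ i % p) ^ m % p   ≡⟨ [[m%d]^n]%d≡[m^n]%d p (z ^ i) m ⟩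
      (z ^ i) ^ m % p       ≡⟨ cong (_% p) (^-*-assoc z i m) ⟩
      z ^ (i * m) % p       ∎
      where open ≡-Reasoning

    s^m%p≡1⇒cycLen∣m : ∀ {m} → s ^ m % p ≡ 1 → cycLen p i ∣ m
    s^m%p≡1⇒cycLen∣m {m} e = n∣i*m⇒n/gcd∣m i (p ∸ 1) (z^n%p≡1⇒p∸1∣n (trans (sym (s^m%p≡z^[i*m]%p m)) e))

    cycLen∣m⇒s^m%p≡1 : ∀ {m} → cycLen p i ∣ m → s ^ m % p ≡ 1
    cycLen∣m⇒s^m%p≡1 {m} c∣m = trans (s^m%p≡z^[i*m]%p m) (p∸1∣n⇒z^n%p≡1 (n/gcd∣m⇒n∣i*m i (p ∸ 1) c∣m))

    module _ {v : ℕ} (0<v : 0 < v) (v<p : v < p) where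

      s^m*v≡v⇒cycLen∣m : ∀ {m} → (s ^ m * v) % p ≡ v → cycLen p i ∣ m
      s^m*v≡v⇒cycLen∣m {m} e =
        s^m%p≡1⇒cycLen∣m (trans (*-cancelˡ-% p-prime (>⇒∤ {{>-nonZero 0<v}} v<p) (begin
        (v * s ^ m) % p   ≡⟨ cong (_% p) (*-comm v (s ^ m)) ⟩
        (s ^ m * v) % p   ≡⟨ e ⟩
        v                 ≡⟨ m<n⇒m%n≡m v<p ⟨
        v % p             ≡⟨ cong (_% p) (*-identityʳ v) ⟨
        (v * 1) % p       ∎)) 1%p≡1)
        where open ≡-Reasoning

      cycLen∣m⇒s^m*v≡v : ∀ {m} → cycLen p i ∣ m → (s ^ m * v) % p ≡ v
      cycLen∣m⇒s^m*v≡v {m} c∣m = begin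
        (s ^ m * v) % p         ≡⟨ [[m%d]*n]%d≡[m*n]%d p (s ^ m) v ⟨
        ((s ^ m % p) * v) % p   ≡⟨ cong (λ r → (r * v) % p) (cycLen∣m⇒s^m%p≡1 c∣m) ⟩
        (1 * v) % p             ≡⟨ cong (_% p) (*-identityˡ v) ⟩
        v % p                   ≡⟨ m<n⇒m%n≡m v<p ⟩
        v                       ∎
        where open ≡-Reasoning

-- The action of α on D₂ₚ ∖ {e}

rotations : ℕ → List D
rotations p = map (λ a → rot (suc a)) (upTo (p ∸ 1))

reflections : ℕ → List D
reflections p = map ref (upTo p)

module _ (p : ℕ) where

  ∈rotations⁻ : x ∈ rotations p → ∃ λ a → 0 < a × a < p × x ≡ rot a
  ∈rotations⁻ x∈ with ∈-map⁻ (λ a → rot (suc a)) x∈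
  ... | a , a∈ , refl = suc a , s≤s z≤n , <∸1⇒suc< (∈-upTo⁻ a∈) , refl

  ∈rotations⁺ : ∀ {a} → 0 < a → a < p → rot a ∈ rotations p
  ∈rotations⁺ {suc a} _ a<p = ∈-map⁺ (λ a → rot (suc a)) (∈-upTo⁺ (suc<⇒<∸1 a<p))

  ∈reflections⁻ : x ∈ reflections p → ∃ λ j → j < p × x ≡ ref j
  ∈reflections⁻ x∈ with ∈-map⁻ ref x∈
  ... | j , j∈ , refl = j , ∈-upTo⁻ j∈ , refl

  ∈reflections⁺ : ∀ {j} → j < p → ref j ∈ reflections p
  ∈reflections⁺ j<p = ∈-map⁺ ref (∈-upTo⁺ j<p)

  length-rotations : length (rotations p) ≡ p ∸ 1
  length-rotations = trans (length-map _ (upTo (p ∸ 1))) (length-upTo (p ∸ 1))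

  length-reflections : length (reflections p) ≡ p
  length-reflections = trans (length-map ref (upTo p)) (length-upTo p)

  reflections-unique : Unique (reflections p)
  reflections-unique = Unique.map⁺ ref-inj (Unique.upTo⁺ p)

  A-unique : Unique (A p)
  A-unique = Unique.++⁺ (Unique.map⁺ (λ e → suc-injective (rot-inj e)) (Unique.upTo⁺ (p ∸ 1)))
                        reflections-unique
                        λ (x∈R , x∈F) → notBoth (∈rotations⁻ x∈R) (∈reflections⁻ x∈F)
    where
    notBoth : (∃ λ a → 0 < a × a < p × x ≡ rot a) → (∃ λ j → j < p × x ≡ ref j) → ⊥
    notBoth (_ , _ , _ , refl) (_ , _ , ())

module _ {p : ℕ} .{{_ : NonZero p}} {s : ℕ} (t : ℕ) where

  reflections-closed : Closed (α p s t) (reflections p)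
  reflections-closed x∈ with ∈reflections⁻ p x∈
  ... | j , _ , refl = ∈reflections⁺ p (m%n<n (s * j + t) p)

  module _ (p-prime : Prime p) (s-unit : IsUnit p s) where

    rotations-closed : Closed (α p s t) (rotations p)
    rotations-closed x∈ with ∈rotations⁻ p x∈
    ... | a , 0<a , a<p , refl = ∈rotations⁺ p
      (∤⇒0<% (∤-* p-prime (>⇒∤ {{>-nonZero (proj₁ s-unit)}} (proj₂ s-unit))
                          (>⇒∤ {{>-nonZero 0<a}} a<p)))
      (m%n<n (s * a) p)

    A-closed : Closed (α p s t) (A p)
    A-closed x∈ with ∈-++⁻ (rotations p) x∈
    ... | inj₁ x∈R = ∈-++⁺ˡ (rotations-closed x∈R)
    ... | inj₂ x∈F = ∈-++⁺ʳ (rotations p) (reflections-closed x∈F)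

    periodCounts≡n*k⇒b≡n : ∀ {k n} .{{_ : NonZero k}} →
      periodCount (α p s t) k (rotations p) + periodCount (α p s t) k (reflections p) ≡ n * k →
      b p (α p s t) k ≡ n
    periodCounts≡n*k⇒b≡n {k} {n} counts = *-cancelʳ-≡ _ n k (begin
      b p (α p s t) k * k
        ≡⟨ cycleCount*k≡periodCount (α p s t) (A-unique p) A-closed ⟩
      periodCount (α p s t) k (rotations p ++ reflections p)
        ≡⟨ periodCount-++ (α p s t) (rotations p) (reflections p) ⟩
      periodCount (α p s t) k (rotations p) + periodCount (α p s t) k (reflections p)
        ≡⟨ counts ⟩
      n * k ∎)
      where open ≡-Reasoning

-- Part (i): the translations α₁,ₜ

module _ {p : ℕ} .{{_ : NonZero p}} (p-prime : Prime p) {t : ℕ} (t<p : t < p) where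

  α₁-fixes-rotations : x ∈ rotations p → HasPeriod (α p 1 t) 1 x
  α₁-fixes-rotations x∈ with ∈rotations⁻ p x∈
  ... | a , _ , a<p , refl =
    fixed⇒hasPeriod1 (α p 1 t) (cong rot (trans (cong (_% p) (*-identityˡ a)) (m<n⇒m%n≡m a<p)))

  α₁-fixes-reflections : t ≡ 0 → x ∈ reflections p → HasPeriod (α p 1 t) 1 x
  α₁-fixes-reflections refl x∈ with ∈reflections⁻ p x∈
  ... | j , j<p , refl = fixed⇒hasPeriod1 (α p 1 0)
    (cong ref (trans (cong (_% p) (trans (+-identityʳ _) (*-identityˡ j))) (m<n⇒m%n≡m j<p)))

  iter-α₁-ref : ∀ {j} → j < p → ∀ m → iter (α p 1 t) m (ref j) ≡ ref ((j + m * t) % p)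
  iter-α₁-ref {j} j<p zero = cong ref (sym (trans (cong (_% p) (+-identityʳ j)) (m<n⇒m%n≡m j<p)))
  iter-α₁-ref {j} j<p (suc m) = trans (cong (α p 1 t) (iter-α₁-ref j<p m)) (cong ref (begin
    (1 * ((j + m * t) % p) + t) % p   ≡⟨ cong (λ r → (r + t) % p) (*-identityˡ _) ⟩
    ((j + m * t) % p + t) % p         ≡⟨ [[m%d]+n]%d≡[m+n]%d p (j + m * t) t ⟩
    (j + m * t + t) % p               ≡⟨ cong (_% p) (+-assoc j (m * t) t) ⟩
    (j + (m * t + t)) % p             ≡⟨ cong (λ r → (j + r) % p) (+-comm (m * t) t) ⟩
    (j + (t + m * t)) % p             ∎))
    where open ≡-Reasoning

  α₁-reflections-period : t ≢ 0 → x ∈ reflections p → HasPeriod (α p 1 t) p x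
  α₁-reflections-period t≢0 x∈ with ∈reflections⁻ p x∈
  ... | j , j<p , refl = returns∧∣⇒hasPeriod (α p 1 t) (<-trans (s≤s z≤n) (1<p p-prime))
    (trans (iter-α₁-ref j<p p) (cong ref (trans (%-remove-+ʳ j (m∣m*n {p} t)) (m<n⇒m%n≡m j<p))))
    λ m ret → [ id , (λ p∣t → contradiction p∣t (>⇒∤ {{≢-nonZero t≢0}} t<p)) ]′
      (euclidsLemma m t p-prime (subst (p ∣_) (m+n∸m≡n j (m * t)) (%≡%⇒∣∸ p (m≤m+n j (m * t))
        (trans (m<n⇒m%n≡m j<p) (sym (ref-inj (trans (sym (iter-α₁-ref j<p m)) ret)))))))

  cycleType-α₁ : (k : ℕ) → 1 ≤ k →
      (k ≡ 1 → t ≡ 0 → b p (α p 1 t) k ≡ 2 * p ∸ 1)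
    × (k ≡ 1 → ¬ (t ≡ 0) → b p (α p 1 t) k ≡ p ∸ 1)
    × (k ≡ p → ¬ (t ≡ 0) → b p (α p 1 t) k ≡ 1)
    × (¬ (k ≡ 1) → ¬ (k ≡ p × ¬ (t ≡ 0)) → b p (α p 1 t) k ≡ 0)
  cycleType-α₁ k@(suc _) _ = allFixed , fixedRotations , oneCycle , noOthers
    where
    g′ : D → D
    g′ = α p 1 t
    b≡ : ∀ n → periodCount g′ k (rotations p) + periodCount g′ k (reflections p) ≡ n * k → b p g′ k ≡ n
    b≡ n = periodCounts≡n*k⇒b≡n t p-prime (s≤s z≤n , 1<p p-prime)

    allFixed : k ≡ 1 → t ≡ 0 → b p g′ k ≡ 2 * p ∸ 1
    allFixed refl t≡0 = b≡ (2 * p ∸ 1) (begin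
      periodCount g′ 1 (rotations p) + periodCount g′ 1 (reflections p)
        ≡⟨ cong₂ _+_ (trans (periodCount-uniform g′ α₁-fixes-rotations) (length-rotations p))
                     (trans (periodCount-uniform g′ (α₁-fixes-reflections t≡0)) (length-reflections p)) ⟩
      p ∸ 1 + p             ≡⟨ n∸1+n≡2*n∸1 (<-trans (s≤s z≤n) (1<p p-prime)) ⟩
      2 * p ∸ 1             ≡⟨ *-identityʳ _ ⟨
      (2 * p ∸ 1) * 1       ∎)
      where open ≡-Reasoning

    fixedRotations : k ≡ 1 → t ≢ 0 → b p g′ k ≡ p ∸ 1
    fixedRotations refl t≢0 = b≡ (p ∸ 1) (begin
      periodCount g′ 1 (rotations p) + periodCount g′ 1 (reflections p)
        ≡⟨ cong₂ _+_ (trans (periodCount-uniform g′ α₁-fixes-rotations) (length-rotations p))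
                     (periodCount-uniform-≢ g′ (α₁-reflections-period t≢0) (λ 1≡p → <-irrefl 1≡p (1<p p-prime))) ⟩
      p ∸ 1 + 0             ≡⟨ +-identityʳ _ ⟩
      p ∸ 1                 ≡⟨ *-identityʳ _ ⟨
      (p ∸ 1) * 1           ∎)
      where open ≡-Reasoning

    oneCycle : k ≡ p → t ≢ 0 → b p g′ k ≡ 1
    oneCycle k≡p t≢0 = b≡ 1 (begin
      periodCount g′ k (rotations p) + periodCount g′ k (reflections p)
        ≡⟨ cong₂ _+_ (periodCount-uniform-≢ g′ α₁-fixes-rotations
                                            (λ k≡1 → <-irrefl (trans (sym k≡1) k≡p) (1<p p-prime)))
                     (trans (subst (λ n → periodCount g′ n (reflections p) ≡ length (reflections p)) (sym k≡p)
                                   (periodCount-uniform g′ (α₁-reflections-period t≢0)))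
                            (length-reflections p)) ⟩
      0 + p                 ≡⟨ k≡p ⟨
      k                     ≡⟨ *-identityˡ k ⟨
      1 * k                 ∎)
      where open ≡-Reasoning

    noOthers : k ≢ 1 → ¬ (k ≡ p × t ≢ 0) → b p g′ k ≡ 0
    noOthers k≢1 ¬pCycle = b≡ 0 (cong₂ _+_ (periodCount-uniform-≢ g′ α₁-fixes-rotations k≢1) reflections-k)
      where
      reflections-k : periodCount g′ k (reflections p) ≡ 0
      reflections-k with t ≟ 0
      ... | yes t≡0 = periodCount-uniform-≢ g′ (α₁-fixes-reflections t≡0) k≢1
      ... | no  t≢0 = periodCount-uniform-≢ g′ (α₁-reflections-period t≢0) (λ k≡p → ¬pCycle (k≡p , t≢0))

-- Part (ii): α_{s,t} with s ≠ 1

affine-semiconj : ∀ p .{{_ : NonZero p}} {s} → 0 < s → ∀ t j →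
  ((s ∸ 1) * ((s * j + t) % p) + t) % p ≡ (s * (((s ∸ 1) * j + t) % p)) % p
affine-semiconj p {suc s′} _ t j = begin
  (s′ * ((suc s′ * j + t) % p) + t) % p         ≡⟨ [[m%d]+n]%d≡[m+n]%d p _ t ⟨
  ((s′ * ((suc s′ * j + t) % p)) % p + t) % p   ≡⟨ cong (λ r → (r + t) % p) ([m*[n%d]]%d≡[m*n]%d p s′ _) ⟩
  ((s′ * (suc s′ * j + t)) % p + t) % p         ≡⟨ [[m%d]+n]%d≡[m+n]%d p _ t ⟩
  (s′ * (suc s′ * j + t) + t) % p               ≡⟨ cong (_% p) (regroup s′ j t) ⟩
  (suc s′ * (s′ * j + t)) % p                   ≡⟨ [m*[n%d]]%d≡[m*n]%d p (suc s′) _ ⟨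
  (suc s′ * ((s′ * j + t) % p)) % p             ∎
  where
  open ≡-Reasoning
  regroup : ∀ s′ j t → s′ * (suc s′ * j + t) + t ≡ suc s′ * (s′ * j + t)
  regroup = solve-∀

module _ {p : ℕ} .{{_ : NonZero p}} (p-prime : Prime p) {z : ℕ} (gen : IsGenerator p z)
         {s : ℕ} (s-unit : IsUnit p s) (s≢1 : s ≢ 1) (i : ℕ) (z^i≡s : z ^ i % p ≡ s) where

  open PrimitiveRoot p-prime gen

  cycLen≢1 : cycLen p i ≢ 1
  cycLen≢1 c≡1 = s≢1 (begin
    s           ≡⟨ m<n⇒m%n≡m (proj₂ s-unit) ⟨
    s % p       ≡⟨ cong (_% p) (*-identityʳ s) ⟨
    s ^ 1 % p   ≡⟨ cycLen∣m⇒s^m%p≡1 i z^i≡s {1} (subst (_∣ 1) (sym c≡1) ∣-refl) ⟩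
    1           ∎)
    where open ≡-Reasoning

  module _ (t : ℕ) where

    iter-α-rot : ∀ {a} → a < p → ∀ m → iter (α p s t) m (rot a) ≡ rot ((s ^ m * a) % p)
    iter-α-rot {a} a<p zero    = cong rot (sym (trans (cong (_% p) (*-identityˡ a)) (m<n⇒m%n≡m a<p)))
    iter-α-rot {a} a<p (suc m) = trans (cong (α p s t) (iter-α-rot a<p m))
      (cong rot (trans ([m*[n%d]]%d≡[m*n]%d p s _) (cong (_% p) (sym (*-assoc s (s ^ m) a)))))

    rotation-period : ∀ {a} → 0 < a → a < p → HasPeriod (α p s t) (cycLen p i) (rot a)
    rotation-period 0<a a<p = returns∧∣⇒hasPeriod (α p s t) (0<cycLen i)
      (trans (iter-α-rot a<p (cycLen p i)) (cong rot (cycLen∣m⇒s^m*v≡v i z^i≡s 0<a a<p ∣-refl)))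
      λ m ret → s^m*v≡v⇒cycLen∣m i z^i≡s 0<a a<p (rot-inj (trans (sym (iter-α-rot a<p m)) ret))

    identity-fixed : HasPeriod (α p s t) 1 (rot 0)
    identity-fixed = fixed⇒hasPeriod1 (α p s t)
      (cong rot (trans (cong (_% p) (*-zeroʳ s)) (m<n⇒m%n≡m (<-trans (s≤s z≤n) (1<p p-prime)))))

    straighten : D → D
    straighten (rot a) = rot a
    straighten (ref j) = rot (((s ∸ 1) * j + t) % p)

    straighten-comm : ∀ y → straighten (α p s t y) ≡ α p s t (straighten y)
    straighten-comm (rot a) = refl
    straighten-comm (ref j) = cong rot (affine-semiconj p (proj₁ s-unit) t j)

    straighten-exponent-injective : ∀ {j j′} → j < p → j′ < p →
      ((s ∸ 1) * j + t) % p ≡ ((s ∸ 1) * j′ + t) % p → j ≡ j′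
    straighten-exponent-injective {j} {j′} j<p j′<p e = begin
      j       ≡⟨ m<n⇒m%n≡m j<p ⟨
      j % p   ≡⟨ *-cancelˡ-% p-prime p∤s∸1 (+-cancelʳ-% p t e) ⟩
      j′ % p  ≡⟨ m<n⇒m%n≡m j′<p ⟩
      j′      ∎
      where
      open ≡-Reasoning
      0<s∸1 : 0 < s ∸ 1
      0<s∸1 = m<n⇒0<n∸m (≤∧≢⇒< (proj₁ s-unit) (λ 1≡s → s≢1 (sym 1≡s)))
      p∤s∸1 : p ∤ s ∸ 1
      p∤s∸1 = >⇒∤ {{>-nonZero 0<s∸1}} (≤-<-trans (m∸n≤m s 1) (proj₂ s-unit))

    straighten-injective : ∀ {y y′} → y ∈ reflections p → y′ ∈ reflections p →
      straighten y ≡ straighten y′ → y ≡ y′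
    straighten-injective y∈ y′∈ e with ∈reflections⁻ p y∈ | ∈reflections⁻ p y′∈
    ... | j , j<p , refl | j′ , j′<p , refl = cong ref (straighten-exponent-injective j<p j′<p (rot-inj e))

    fixedReflection : ∃ λ j₀ → j₀ < p × straighten (ref j₀) ≡ rot 0
    fixedReflection with injective⇒surjective p (λ j → ((s ∸ 1) * j + t) % p) (λ _ → m%n<n _ p)
                           straighten-exponent-injective (<-trans (s≤s z≤n) (1<p p-prime))
    ... | j₀ , j₀<p , e = j₀ , j₀<p , cong rot e

    j₀ : ℕ
    j₀ = proj₁ fixedReflection

    ref-j₀∈ : ref j₀ ∈ reflections p
    ref-j₀∈ = ∈reflections⁺ p (proj₁ (proj₂ fixedReflection))

    reflection-period : ∀ {k} → x ∈ reflections p →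
      HasPeriod (α p s t) k (straighten x) → HasPeriod (α p s t) k x
    reflection-period = hasPeriod-conj (α p s t) straighten-comm (reflections-closed t) straighten-injective

    ref-j₀-fixed : HasPeriod (α p s t) 1 (ref j₀)
    ref-j₀-fixed = reflection-period ref-j₀∈
      (subst (HasPeriod (α p s t) 1) (sym (proj₂ (proj₂ fixedReflection))) identity-fixed)

    reflection-cases : x ∈ reflections p → x ≡ ref j₀ ⊎ HasPeriod (α p s t) (cycLen p i) x
    reflection-cases x∈ with ∈reflections⁻ p x∈
    ... | j , j<p , refl with ((s ∸ 1) * j + t) % p in eq
    ...   | zero  = inj₁ (straighten-injective x∈ ref-j₀∈
                             (trans (cong rot eq) (sym (proj₂ (proj₂ fixedReflection)))))
    ...   | suc r = inj₂ (reflection-period x∈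
                             (subst (λ v → HasPeriod (α p s t) (cycLen p i) (rot v)) (sym eq)
                                    (rotation-period (s≤s z≤n) (subst (_< p) eq (m%n<n ((s ∸ 1) * j + t) p)))))

    cycleType-α : (k : ℕ) → 1 ≤ k →
        (k ≡ 1 → b p (α p s t) k ≡ 1)
      × (k ≡ cycLen p i → b p (α p s t) k ≡ 2 * gcd i (p ∸ 1))
      × (¬ (k ≡ 1) → ¬ (k ≡ cycLen p i) → b p (α p s t) k ≡ 0)
    cycleType-α k@(suc _) _ = fixedPoints , cycles , noOthers
      where
      c : ℕ
      c = cycLen p i
      g′ : D → D
      g′ = α p s t
      rotations-c : ∀ {y} → y ∈ rotations p → HasPeriod g′ c y
      rotations-c y∈ with ∈rotations⁻ p y∈
      ... | a , 0<a , a<p , refl = rotation-period 0<a a<p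
      b≡ : ∀ n → periodCount g′ k (rotations p) + periodCount g′ k (reflections p) ≡ n * k → b p g′ k ≡ n
      b≡ n = periodCounts≡n*k⇒b≡n t p-prime s-unit

      fixedPoints : k ≡ 1 → b p g′ k ≡ 1
      fixedPoints refl = b≡ 1 (cong₂ _+_ (periodCount-uniform-≢ g′ rotations-c (λ 1≡c → cycLen≢1 (sym 1≡c)))
        (periodCount-fixed g′ (reflections-unique p) ref-j₀∈ ref-j₀-fixed cycLen≢1 reflection-cases))

      cycles : k ≡ c → b p g′ k ≡ 2 * gcd i (p ∸ 1)
      cycles k≡c = b≡ (2 * gcd i (p ∸ 1)) (begin
        periodCount g′ k (rotations p) + periodCount g′ k (reflections p)
          ≡⟨ cong₂ _+_ (at-c {rotations p} (trans (periodCount-uniform g′ rotations-c) (length-rotations p)))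
                       (at-c {reflections p} (trans (periodCount-others g′ (reflections-unique p) ref-j₀∈
                                                                         ref-j₀-fixed cycLen≢1 reflection-cases)
                                                    (cong (_∸ 1) (length-reflections p)))) ⟩
        (p ∸ 1) + (p ∸ 1)                   ≡⟨ cong (λ n → n + n) (_∣_.equality (gcd[m,n]∣n i (p ∸ 1))) ⟩
        c * gcd i (p ∸ 1) + c * gcd i (p ∸ 1) ≡⟨ double c (gcd i (p ∸ 1)) ⟩
        2 * gcd i (p ∸ 1) * c               ≡⟨ cong (2 * gcd i (p ∸ 1) *_) k≡c ⟨
        2 * gcd i (p ∸ 1) * k               ∎)
        where
        open ≡-Reasoning
        at-c : ∀ {L n} → periodCount g′ c L ≡ n → periodCount g′ k L ≡ n
        at-c {L} {n} = subst (λ m → periodCount g′ m L ≡ n) (sym k≡c)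
        double : ∀ c d → c * d + c * d ≡ 2 * d * c
        double = solve-∀

      noOthers : k ≢ 1 → k ≢ c → b p g′ k ≡ 0
      noOthers k≢1 k≢c = b≡ 0 (cong₂ _+_ (periodCount-uniform-≢ g′ rotations-c k≢c)
        (periodCount-neither g′ (reflections-unique p) ref-j₀∈ ref-j₀-fixed cycLen≢1 reflection-cases
                             k≢1 k≢c))

  cycleType-α-independent-of-t : ∀ t k → 1 ≤ k → b p (α p s t) k ≡ b p (α p s 0) k
  cycleType-α-independent-of-t t k 1≤k
    with cycleType-α t k 1≤k | cycleType-α 0 k 1≤k | k ≟ 1 | k ≟ cycLen p i
  ... | fixed , _ , _ | fixed₀ , _ , _ | yes k≡1 | _        = trans (fixed k≡1) (sym (fixed₀ k≡1))
  ... | _ , cycles , _ | _ , cycles₀ , _ | no _ | yes k≡c = trans (cycles k≡c) (sym (cycles₀ k≡c))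
  ... | _ , _ , none | _ , _ , none₀ | no k≢1 | no k≢c    = trans (none k≢1 k≢c) (sym (none₀ k≢1 k≢c))

lemma3p1 : (p : ℕ) .{{_ : NonZero p}} → Prime p → ¬ (2 ∣ p) →
    ((t : ℕ) → t < p → (k : ℕ) → 1 ≤ k → k ≤ 2 * p ∸ 1 →
        (k ≡ 1 → t ≡ 0 → b p (α p 1 t) k ≡ 2 * p ∸ 1)
      × (k ≡ 1 → ¬ (t ≡ 0) → b p (α p 1 t) k ≡ p ∸ 1)
      × (k ≡ p → ¬ (t ≡ 0) → b p (α p 1 t) k ≡ 1)
      × (¬ (k ≡ 1) → ¬ (k ≡ p × ¬ (t ≡ 0)) → b p (α p 1 t) k ≡ 0))
    ×
    ((z : ℕ) → IsGenerator p z → (s : ℕ) → IsUnit p s → ¬ (s ≡ 1) →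
     (i : ℕ) → i < p ∸ 1 → z ^ i % p ≡ s →
     (t : ℕ) → t < p → (k : ℕ) → 1 ≤ k → k ≤ 2 * p ∸ 1 →
        (b p (α p s t) k ≡ b p (α p s 0) k)
      × (k ≡ 1 → b p (α p s t) k ≡ 1)
      × (k ≡ cycLen p i → b p (α p s t) k ≡ 2 * gcd i (p ∸ 1))
      × (¬ (k ≡ 1) → ¬ (k ≡ cycLen p i) → b p (α p s t) k ≡ 0))
lemma3p1 p p-prime _ =
  (λ t t<p k 1≤k _ → cycleType-α₁ p-prime t<p k 1≤k) ,
  λ z gen s s-unit s≢1 i _ z^i≡s t _ k 1≤k _ →
    cycleType-α-independent-of-t p-prime gen s-unit s≢1 i z^i≡s t k 1≤k ,
    cycleType-α p-prime gen s-unit s≢1 i z^i≡s t k 1≤k
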